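{- Let $G$ be a finite simple graph and let $\kappa(G)$ be the number of vertices not contained in any cycle of $G$. Then \[\mathrm{girth}(G)-1+\kappa(G)\leq\gamma_{cy}(G),\] where $\mathrm{girth}(G)=1$ if $G$ is a forest and otherwise $\mathrm{girth}(G)$ is the length of a shortest cycle.
   Context: For $S\subseteq V$, $\langle S\rangle$ is the induced subgraph. $S$ is cycle dominating if for every $u\in V\setminus S$ there is a cycle in $\langle S\cup\{u\}\rangle$ containing $u$; $\gamma_{cy}(G)$ is the minimum size of a cycle dominating set. -}

module Defs where

open import Data.Nat using (ℕ; _≤_; _∸_; _+_)
open import Data.Bool using (Bool; T; false)
open import Data.Fin using (Fin)
open import Data.Fin.Subset using (Subset; _∈_; _∉_; ∣_∣)
open import Data.List using (List; []; _∷_; _++_; [_]; length)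
open import Data.List.Relation.Unary.All using (All)
open import Data.List.Relation.Unary.Linked using (Linked)
open import Data.List.Relation.Unary.Unique.Propositional using (Unique)
import Data.List.Membership.Propositional as L
open import Data.Product using (Σ; ∃; _×_)
open import Data.Sum using (_⊎_)
open import Data.Empty using (⊥)
open import Relation.Nullary using (¬_)
open import Relation.Binary.PropositionalEquality using (_≡_)

record Graph (n : ℕ) : Set where
  field
    adj   : Fin n → Fin n → Bool
    sym   : ∀ x y → adj x y ≡ adj y x
    irrefl : ∀ x → adj x x ≡ false

open Graph public

Edge : ∀ {n} → Graph n → Fin n → Fin n → Set
Edge G x y = T (adj G x y)

-- A cycle of G, given as the list of its (distinct) vertices v₀ … v_{k-1},
-- with k ≥ 3, v_i adjacent to v_{i+1}, and v_{k-1} adjacent to v₀.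
IsCycle : ∀ {n} → Graph n → List (Fin n) → Set
IsCycle G []       = ⊥
IsCycle G (v ∷ ws) =
  Unique (v ∷ ws) × (3 ≤ length (v ∷ ws)) × Linked (Edge G) (v ∷ ws ++ [ v ])

HasCycle : ∀ {n} → Graph n → Set
HasCycle G = ∃ λ cs → IsCycle G cs

OnCycle : ∀ {n} → Graph n → Fin n → Set
OnCycle G v = ∃ λ cs → IsCycle G cs × v L.∈ cs

-- S is cycle dominating: every u ∉ S lies on a cycle of the induced
-- subgraph ⟨S ∪ {u}⟩ (i.e. a cycle of G all of whose vertices are in S ∪ {u}).
CycleDominating : ∀ {n} → Graph n → Subset n → Set
CycleDominating {n} G S =
  ∀ (u : Fin n) → u ∉ S →
    ∃ λ cs → IsCycle G cs × u L.∈ cs × All (λ w → w ∈ S ⊎ w ≡ u) cs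

IsCycleDominationNumber : ∀ {n} → Graph n → ℕ → Set
IsCycleDominationNumber G γ =
  (Σ _ λ S → CycleDominating G S × ∣ S ∣ ≡ γ) ×
  (∀ S → CycleDominating G S → γ ≤ ∣ S ∣)

IsGirth : ∀ {n} → Graph n → ℕ → Set
IsGirth G g =
  (¬ HasCycle G × g ≡ 1) ⊎
  ((Σ _ λ cs → IsCycle G cs × length cs ≡ g) ×
   (∀ cs → IsCycle G cs → g ≤ length cs))

IsAcyclicVertexSet : ∀ {n} → Graph n → Subset n → Set
IsAcyclicVertexSet {n} G K = ∀ (v : Fin n) → (v ∈ K → ¬ OnCycle G v) × (¬ OnCycle G v → v ∈ K)

-- Let S be a minimum cycle dominating set. A vertex on no cycle cannot be
-- dominated, so K ⊆ S. If G has a cycle, then either S is the whole vertex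
-- set or some u ∉ S is dominated; either way some cycle C lies inside
-- S ∪ {u}. C has at least girth(G) vertices, none of them in K, hence at
-- least girth(G) − 1 vertices in S ∖ K.
module Submission where

open import Defs
open import Data.Nat using (ℕ; suc; z≤n; s≤s; _≤_; _∸_; _+_)
open import Data.Nat.Properties
  using (≤-trans; ≤-pred; n≤1+n; +-suc; +-comm; +-monoˡ-≤; +-monoʳ-≤; ∸-monoˡ-≤; module ≤-Reasoning)
open import Data.Bool using (true; false)
open import Data.Vec using ([]; _∷_)
open import Data.Fin using (Fin)
open import Data.Fin.Subset using (Subset; ∣_∣; _∈_; _∉_; _⊆_; _∪_; _-_; ⁅_⁆)
open import Data.Fin.Subset.Properties
  using (_∈?_; p⊆q⇒∣p∣≤∣q∣; x∈p⇒∣p-x∣<∣p∣; x∈p∧x∉q⇒x∈p─q; x≢y⇒x∉⁅y⁆;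
         x∈p∪q⁺; x∈⁅x⁆; ∣⁅x⁆∣≡1)
open import Data.Fin.Properties using (all?; ¬∀⟶∃¬)
open import Data.List using (List; []; _∷_; length)
open import Data.List.Relation.Unary.All as All using (All; []; _∷_)
open import Data.List.Relation.Unary.AllPairs using (_∷_)
open import Data.List.Relation.Unary.Unique.Propositional using (Unique)
open import Data.Product using (∃; _×_; _,_; proj₁)
open import Data.Sum using (_⊎_; inj₁; inj₂)
open import Function using (_∘_)
open import Relation.Nullary using (yes; no)
import Relation.Binary.PropositionalEquality as ≡
open import Relation.Binary.PropositionalEquality using (_≡_; _≢_; refl; cong; subst; ≢-sym)

private variable n : ℕ

∣p∪q∣≤∣p∣+∣q∣ : ∀ (p q : Subset n) → ∣ p ∪ q ∣ ≤ ∣ p ∣ + ∣ q ∣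
∣p∪q∣≤∣p∣+∣q∣ []            []            = z≤n
∣p∪q∣≤∣p∣+∣q∣ (false ∷ p)   (false ∷ q)   = ∣p∪q∣≤∣p∣+∣q∣ p q
∣p∪q∣≤∣p∣+∣q∣ (false ∷ p)   (true ∷ q)    =
  subst (suc ∣ p ∪ q ∣ ≤_) (≡.sym (+-suc ∣ p ∣ ∣ q ∣)) (s≤s (∣p∪q∣≤∣p∣+∣q∣ p q))
∣p∪q∣≤∣p∣+∣q∣ (true ∷ p)    (false ∷ q)   = s≤s (∣p∪q∣≤∣p∣+∣q∣ p q)
∣p∪q∣≤∣p∣+∣q∣ (true ∷ p)    (true ∷ q)    =
  s≤s (≤-trans (∣p∪q∣≤∣p∣+∣q∣ p q) (+-monoʳ-≤ ∣ p ∣ (n≤1+n ∣ q ∣)))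

∣p∪⁅x⁆∣≤1+∣p∣ : ∀ (p : Subset n) (x : Fin n) → ∣ p ∪ ⁅ x ⁆ ∣ ≤ suc ∣ p ∣
∣p∪⁅x⁆∣≤1+∣p∣ p x = begin
  ∣ p ∪ ⁅ x ⁆ ∣     ≤⟨ ∣p∪q∣≤∣p∣+∣q∣ p ⁅ x ⁆ ⟩
  ∣ p ∣ + ∣ ⁅ x ⁆ ∣ ≡⟨ cong (∣ p ∣ +_) (∣⁅x⁆∣≡1 x) ⟩
  ∣ p ∣ + 1         ≡⟨ +-comm ∣ p ∣ 1 ⟩
  suc ∣ p ∣         ∎
  where open ≤-Reasoning

x∈p-y : ∀ {p : Subset n} {x y} → x ∈ p → x ≢ y → x ∈ p - y
x∈p-y x∈p x≢y = x∈p∧x∉q⇒x∈p─q x∈p (x≢y⇒x∉⁅y⁆ x≢y)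

length+∣p∣≤∣q∣ : ∀ {p q : Subset n} {xs : List (Fin n)} → Unique xs →
  All (_∈ q) xs → All (_∉ p) xs → p ⊆ q → length xs + ∣ p ∣ ≤ ∣ q ∣
length+∣p∣≤∣q∣ {xs = []}     _              _            _            p⊆q =
  p⊆q⇒∣p∣≤∣q∣ p⊆q
length+∣p∣≤∣q∣ {p = p} {q} {x ∷ xs} (x∉xs ∷ uniq) (x∈q ∷ xs⊆q) (x∉p ∷ xs#p) p⊆q = begin
  suc (length xs + ∣ p ∣) ≤⟨ s≤s (length+∣p∣≤∣q∣ uniq xs⊆q-x xs#p p⊆q-x) ⟩
  suc ∣ q - x ∣           ≤⟨ x∈p⇒∣p-x∣<∣p∣ x∈q ⟩
  ∣ q ∣                   ∎
  where
  open ≤-Reasoning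
  xs⊆q-x : All (_∈ q - x) xs
  xs⊆q-x = All.zipWith (λ (y∈q , x≢y) → x∈p-y y∈q (≢-sym x≢y)) (xs⊆q , x∉xs)
  p⊆q-x : p ⊆ q - x
  p⊆q-x y∈p = x∈p-y (p⊆q y∈p) λ { refl → x∉p y∈p }

module _ {n : ℕ} (G : Graph n) where

  cycle-unique : ∀ {cs} → IsCycle G cs → Unique cs
  cycle-unique {_ ∷ _} (uniq , _) = uniq

  cycle-avoids-acyclic : ∀ {K cs} → IsAcyclicVertexSet G K → IsCycle G cs → All (_∉ K) cs
  cycle-avoids-acyclic {cs = cs} acyclic cycle =
    All.tabulate λ {v} v∈cs v∈K → proj₁ (acyclic v) v∈K (cs , cycle , v∈cs)

  acyclic⊆cycleDominating : ∀ {K S} → IsAcyclicVertexSet G K → CycleDominating G S → K ⊆ S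
  acyclic⊆cycleDominating {S = S} acyclic dom {v} v∈K with v ∈? S
  ... | yes v∈S = v∈S
  ... | no v∉S with dom v v∉S
  ... | cs , cycle , v∈cs , _ with () ← proj₁ (acyclic v) v∈K (cs , cycle , v∈cs)

  cycleDominating⇒cycle⊆S∪⁅u⁆ : ∀ {S cs₀} → CycleDominating G S → IsCycle G cs₀ →
    ∃ λ u → ∃ λ cs → IsCycle G cs × All (_∈ S ∪ ⁅ u ⁆) cs
  cycleDominating⇒cycle⊆S∪⁅u⁆ {S} {v ∷ cs₀} dom cycle₀ with all? (_∈? S)
  ... | yes all∈S = v , v ∷ cs₀ , cycle₀ , All.tabulate λ {w} _ → x∈p∪q⁺ (inj₁ (all∈S w))
  ... | no ¬all∈S with ¬∀⟶∃¬ n (_∈ S) (_∈? S) ¬all∈S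
  ... | u , u∉S with dom u u∉S
  ... | cs , cycle , _ , cs⊆S∪u = u , cs , cycle , All.map x∈S∪⁅u⁆ cs⊆S∪u
    where
    x∈S∪⁅u⁆ : ∀ {w} → w ∈ S ⊎ w ≡ u → w ∈ S ∪ ⁅ u ⁆
    x∈S∪⁅u⁆ (inj₁ w∈S)  = x∈p∪q⁺ (inj₁ w∈S)
    x∈S∪⁅u⁆ (inj₂ refl) = x∈p∪q⁺ (inj₂ (x∈⁅x⁆ u))

  length∸1+∣K∣≤∣S∣ : ∀ {K S u cs} → IsAcyclicVertexSet G K → K ⊆ S →
    IsCycle G cs → All (_∈ S ∪ ⁅ u ⁆) cs → length cs ∸ 1 + ∣ K ∣ ≤ ∣ S ∣
  length∸1+∣K∣≤∣S∣ {K} {S} {u} {cs@(_ ∷ _)} acyclic K⊆S cycle cs⊆S∪u =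
    ≤-pred (≤-trans counted (∣p∪⁅x⁆∣≤1+∣p∣ S u))
    where
    counted : length cs + ∣ K ∣ ≤ ∣ S ∪ ⁅ u ⁆ ∣
    counted = length+∣p∣≤∣q∣ (cycle-unique cycle) cs⊆S∪u
      (cycle-avoids-acyclic acyclic cycle) (x∈p∪q⁺ ∘ inj₁ ∘ K⊆S)

mainTheorem9 : ∀ {n} (G : Graph n) (g γ : ℕ) (K : Subset n) →
    IsGirth G g → IsCycleDominationNumber G γ → IsAcyclicVertexSet G K →
    g ∸ 1 + ∣ K ∣ ≤ γ
mainTheorem9 G g γ K girth ((S , dom , ∣S∣≡γ) , _) acyclic =
  subst (g ∸ 1 + ∣ K ∣ ≤_) ∣S∣≡γ (bound girth)
  where
  K⊆S : K ⊆ S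
  K⊆S = acyclic⊆cycleDominating G acyclic dom
  bound : IsGirth G g → g ∸ 1 + ∣ K ∣ ≤ ∣ S ∣
  bound (inj₁ (_ , refl)) = p⊆q⇒∣p∣≤∣q∣ K⊆S
  bound (inj₂ ((_ , cycle₀ , _) , shortest))
    with u , cs , cycle , cs⊆S∪u ← cycleDominating⇒cycle⊆S∪⁅u⁆ G dom cycle₀ =
    ≤-trans (+-monoˡ-≤ ∣ K ∣ (∸-monoˡ-≤ 1 (shortest cs cycle)))
            (length∸1+∣K∣≤∣S∣ G acyclic K⊆S cycle cs⊆S∪u)
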